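{- Let $P=\{P_n(x)\}_{n\ge0}$ and $P^\vee=\{P^\vee_n(x)\}_{n\ge0}$. Then \[ \mathcal{F}_{P^\vee}=\mathcal{L}_P^\vee,\qquad \mathcal{L}_{P^\vee}=\mathcal{F}_P^\vee . \]
   Context: Let $\{b_n\}_{n\ge0},\{a_n\}_{n\ge0}$ be sequences of complex numbers and define $P_{ -1}(x)=0$, $P_0(x)=1$, $P_{n+1}(x)=(x-b_n)P_n(x)-a_nxP_{n-1}(x)$ for $n\ge0$. Assume $P_n(0)\neq0$ and $a_n\neq0$ for all $n\ge1$. Let $V$ be the vector space of Laurent polynomials. For any such sequence $P$ of polynomials, $\mathcal{L}_P$ denotes the unique linear functional on $V$ with $\mathcal{L}_P(1)=1$ and $\mathcal{L}_P(x^{ -n}P_m(x))=0$ for $0<n\le m$, and $\mathcal{F}_P$ denotes the unique linear functional on $V$ with $\mathcal{F}_P(1)=1$ and $\mathcal{F}_P(x^{ -n}P_m(x))=0$ for $0\le n<m$. The inverted polynomials are $P^\vee_n(x)=x^nP_n(x^{ -1})/P_n(0)$; they satisfy $P^\vee_{n+1}(x)=(x-b^\vee_n)P^\vee_n(x)-a^\vee_nxP^\vee_{n-1}(x)$ with $b^\vee_n=1/b_n$, $a^\vee_n=a_n/(b_{n-1}b_n)$. For a linear functional $\mathcal{M}$ on $V$, $\mathcal{M}^\vee$ is defined by $\mathcal{M}^\vee(f(x))=\mathcal{M}(f(x^{ -1}))$. -}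

module Defs where

open import Level using (Level; _⊔_; suc)
open import Algebra.Bundles using (CommutativeRing)
open import Data.Nat as ℕ using (ℕ; zero) renaming (suc to sucℕ)
open import Data.Integer as ℤ using (ℤ; +_)
open import Data.List using (List; []; _∷_; map; reverse)
open import Data.Product using (_×_; _,_)
open import Relation.Nullary using (¬_)

record Field (c ℓ : Level) : Set (suc (c ⊔ ℓ)) where
  field
    commutativeRing : CommutativeRing c ℓ
  open CommutativeRing commutativeRing public
  field
    _⁻¹      : Carrier → Carrier
    0≉1      : ¬ (0# ≈ 1#)
    ⁻¹-inverse : ∀ x → ¬ (x ≈ 0#) → (x * x ⁻¹) ≈ 1#

module FieldTheory {c ℓ : Level} (F : Field c ℓ) where
  open Field F

  -- Polynomials: coefficient lists, constant term first.
  Poly : Set c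
  Poly = List Carrier

  _⊕_ : Poly → Poly → Poly
  [] ⊕ q = q
  (x ∷ p) ⊕ [] = x ∷ p
  (x ∷ p) ⊕ (y ∷ q) = (x + y) ∷ (p ⊕ q)

  _·_ : Carrier → Poly → Poly
  k · p = map (k *_) p

  X* : Poly → Poly
  X* p = 0# ∷ p

  at0 : Poly → Carrier
  at0 []      = 0#
  at0 (x ∷ _) = x

  -- The pair (P_{n-1}, P_n) defined by
  --   P_{-1} = 0, P_0 = 1,
  --   P_{n+1}(x) = (x - b_n) P_n(x) - a_n x P_{n-1}(x).
  Ppair : (b a : ℕ → Carrier) → ℕ → Poly × Poly
  Ppair b a zero = [] , (1# ∷ [])
  Ppair b a (sucℕ n) with Ppair b a n
  ... | (p₋ , p) = p , ((X* p ⊕ ((- b n) · p)) ⊕ ((- a n) · X* p₋))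

  P : (b a : ℕ → Carrier) → ℕ → Poly
  P b a n with Ppair b a n
  ... | (_ , p) = p

  -- Inverted polynomials P^∨_n(x) = x^n P_n(1/x) / P_n(0).
  -- P_n has coefficient list of length exactly n+1 (by construction),
  -- so x^n P_n(1/x) is the reversed coefficient list.
  Pinv : (b a : ℕ → Carrier) → ℕ → Poly
  Pinv b a n = (at0 (P b a n) ⁻¹) · reverse (P b a n)

  -- Laurent polynomials: finite formal sums Σ c_i x^{k_i}, as lists of
  -- (exponent, coefficient) pairs.
  Laurent : Set c
  Laurent = List (ℤ × Carrier)

  shiftL : ℤ → Poly → Laurent
  shiftL k []      = []
  shiftL k (x ∷ p) = (k , x) ∷ shiftL (k ℤ.+ + 1) p

  invertL : Laurent → Laurent
  invertL = map (λ { (k , x) → (ℤ.- k , x) })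

  -- A linear functional on V is determined by (and identified with) its
  -- moment sequence μ k = M(x^k), k ∈ ℤ; it acts on Laurent polynomials by
  -- linearity.
  Functional : Set c
  Functional = ℤ → Carrier

  apply : Functional → Laurent → Carrier
  apply μ []            = 0#
  apply μ ((k , x) ∷ f) = (x * μ k) + apply μ f

  one : Laurent
  one = (+ 0 , 1#) ∷ []

  dual : Functional → Functional
  dual μ k = apply μ (invertL ((k , 1#) ∷ []))

  IsL : (ℕ → Poly) → Functional → Set ℓ
  IsL Q μ = (apply μ one ≈ 1#)
          × (∀ n m → 0 ℕ.< n → n ℕ.≤ m → apply μ (shiftL (ℤ.- (+ n)) (Q m)) ≈ 0#)

  IsF : (ℕ → Poly) → Functional → Set ℓ
  IsF Q μ = (apply μ one ≈ 1#)
          × (∀ n m → n ℕ.< m → apply μ (shiftL (ℤ.- (+ n)) (Q m)) ≈ 0#)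

-- Inversion x ↦ x⁻¹ sends x^{-(m-k)} P^∨_m(x) to x^{-k} P_m(x) / P_m(0).  Hence M annihilates
-- x^{-k} P_m exactly when M^∨ annihilates x^{-(m-k)} P^∨_m, and 0 < k ≤ m iff 0 ≤ m - k < m:
-- inversion exchanges the L- and F-conditions, so L_P^∨ satisfies the conditions defining
-- F_{P^∨}, and F_P^∨ those defining L_{P^∨}.  These conditions determine the functional:
-- P^∨_m has degree m and nonzero constant and leading coefficients, so each condition solves
-- for one new moment, working outwards from the moment at 0.
module Submission where

open import Defs
open import Level using (Level)
open import Data.Nat using (ℕ; _≤_)
open import Data.Product using (_×_)
open import Relation.Nullary using (¬_)

open import Data.Nat as ℕ using (zero; suc; _<_; _⊔_; _∸_; z≤n; s≤s; s≤s⁻¹)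
import Data.Nat.Properties as ℕP
open import Data.Nat.Induction using (<-rec)
open import Data.Integer as ℤ using (+_; -[1+_]; _⊖_)
import Data.Integer.Properties as ℤP
open import Data.Integer.Tactic.RingSolver using (solve-∀)
open import Data.List using ([]; _∷_; _++_; [_]; length; reverse)
import Data.List.Properties as LP
open import Data.Product using (_,_; proj₁; proj₂)
open import Data.Sum using (inj₁; inj₂)
open import Data.Empty using (⊥-elim)
open import Relation.Binary.PropositionalEquality as Eq using (_≡_; _≢_)
import Algebra.Properties.Ring as RingProperties
import Algebra.Properties.CommutativeSemigroup as CommutativeSemigroupProperties
import Algebra.Properties.Group as GroupProperties
open import Algebra.Bundles using (AbelianGroup)

module Inversion {c ℓ : Level} (F : Field c ℓ) where
  open Field F
  open FieldTheory F
  open import Relation.Binary.Reasoning.Setoid setoid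
  open RingProperties ring using (x[y-z]≈xy-xz; -‿+-comm)
  open CommutativeSemigroupProperties +-commutativeSemigroup using (interchange)
  open GroupProperties (AbelianGroup.group +-abelianGroup) using (x∙y⁻¹≈ε⇒x≈y)

  x≉0∧x*y≈0⇒y≈0 : ∀ {x y} → ¬ (x ≈ 0#) → x * y ≈ 0# → y ≈ 0#
  x≉0∧x*y≈0⇒y≈0 {x} {y} x≉0 xy≈0 = begin
    y                 ≈⟨ sym (*-identityˡ y) ⟩
    1# * y            ≈⟨ *-congʳ (sym (⁻¹-inverse x x≉0)) ⟩
    (x * x ⁻¹) * y    ≈⟨ *-congʳ (*-comm x (x ⁻¹)) ⟩
    (x ⁻¹ * x) * y    ≈⟨ *-assoc (x ⁻¹) x y ⟩
    x ⁻¹ * (x * y)    ≈⟨ *-congˡ xy≈0 ⟩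
    x ⁻¹ * 0#         ≈⟨ zeroʳ (x ⁻¹) ⟩
    0#                ∎

  ⁻¹-≉0 : ∀ {x} → ¬ (x ≈ 0#) → ¬ (x ⁻¹ ≈ 0#)
  ⁻¹-≉0 {x} x≉0 x⁻¹≈0 = 0≉1 (begin
    0#        ≈⟨ sym (zeroʳ x) ⟩
    x * 0#    ≈⟨ *-congˡ (sym x⁻¹≈0) ⟩
    x * x ⁻¹  ≈⟨ ⁻¹-inverse x x≉0 ⟩
    1#        ∎)

  *-annihilatesʳ : ∀ x {y} → y ≈ 0# → x * y ≈ 0#
  *-annihilatesʳ x y≈0 = trans (*-congˡ y≈0) (zeroʳ x)

  coeff : Poly → ℕ → Carrier
  coeff []      _       = 0#
  coeff (x ∷ p) zero    = x
  coeff (x ∷ p) (suc j) = coeff p j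

  coeff-zero : ∀ p → coeff p 0 ≡ at0 p
  coeff-zero []      = Eq.refl
  coeff-zero (x ∷ p) = Eq.refl

  coeff-≥length : ∀ p j → length p ≤ j → coeff p j ≈ 0#
  coeff-≥length []      j       _         = refl
  coeff-≥length (x ∷ p) (suc j) (s≤s p≤j) = coeff-≥length p j p≤j

  coeff-⊕ : ∀ p q j → coeff (p ⊕ q) j ≈ coeff p j + coeff q j
  coeff-⊕ []      q       j       = sym (+-identityˡ _)
  coeff-⊕ (x ∷ p) []      j       = sym (+-identityʳ _)
  coeff-⊕ (x ∷ p) (y ∷ q) zero    = refl
  coeff-⊕ (x ∷ p) (y ∷ q) (suc j) = coeff-⊕ p q j

  coeff-· : ∀ k p j → coeff (k · p) j ≈ k * coeff p j
  coeff-· k []      j       = sym (zeroʳ k)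
  coeff-· k (x ∷ p) zero    = refl
  coeff-· k (x ∷ p) (suc j) = coeff-· k p j

  coeff-++ˡ : ∀ p q j → j < length p → coeff (p ++ q) j ≡ coeff p j
  coeff-++ˡ (x ∷ p) q zero    _         = Eq.refl
  coeff-++ˡ (x ∷ p) q (suc j) (s≤s j<p) = coeff-++ˡ p q j j<p

  coeff-++-length : ∀ p q → coeff (p ++ q) (length p) ≡ coeff q 0
  coeff-++-length []      q = Eq.refl
  coeff-++-length (x ∷ p) q = coeff-++-length p q

  coeff-reverse : ∀ p j → j < length p → coeff (reverse p) j ≡ coeff p (length p ∸ suc j)
  coeff-reverse (x ∷ p) j j<1+p rewrite LP.unfold-reverse x p
    with ℕP.m≤n⇒m<n∨m≡n (s≤s⁻¹ j<1+p)
  ... | inj₁ j<p = Eq.trans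
    (coeff-++ˡ (reverse p) [ x ] j (Eq.subst (j <_) (Eq.sym (LP.length-reverse p)) j<p))
    (Eq.trans (coeff-reverse p j j<p) (Eq.cong (coeff (x ∷ p)) (Eq.sym (ℕP.+-∸-assoc 1 j<p))))
  ... | inj₂ Eq.refl = Eq.trans
    (Eq.subst (λ L → coeff (reverse p ++ [ x ]) L ≡ x) (LP.length-reverse p)
              (coeff-++-length (reverse p) [ x ]))
    (Eq.cong (coeff (x ∷ p)) (Eq.sym (ℕP.n∸n≡0 (length p))))

  length-⊕ : ∀ p q → length (p ⊕ q) ≡ length p ⊔ length q
  length-⊕ []      q       = Eq.refl
  length-⊕ (x ∷ p) []      = Eq.refl
  length-⊕ (x ∷ p) (y ∷ q) = Eq.cong suc (length-⊕ p q)

  length-· : ∀ k p → length (k · p) ≡ length p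
  length-· k = LP.length-map (k *_)

  IsMonicOfDegree : ℕ → Poly → Set ℓ
  IsMonicOfDegree n p = (length p ≡ suc n) × (coeff p n ≈ 1#)

  monic-recurrence : ∀ {n} β α p₋ p → length p₋ ≤ n → IsMonicOfDegree n p →
                     IsMonicOfDegree (suc n) ((X* p ⊕ (β · p)) ⊕ (α · X* p₋))
  monic-recurrence {n} β α p₋ p p₋≤n (p≡1+n , lead≈1) = length≡ , lead≈
    where
    A C : Poly
    A = X* p ⊕ (β · p)
    C = α · X* p₋
    βp≡1+n : length (β · p) ≡ suc n
    βp≡1+n = Eq.trans (length-· β p) p≡1+n
    C≤1+n : length C ≤ suc n
    C≤1+n = Eq.subst (_≤ suc n) (Eq.sym (length-· α (X* p₋))) (s≤s p₋≤n)
    A≡2+n : length A ≡ suc (suc n)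
    A≡2+n = Eq.trans (length-⊕ (X* p) (β · p))
      (Eq.trans (Eq.cong₂ _⊔_ (Eq.cong suc p≡1+n) βp≡1+n) (ℕP.m≥n⇒m⊔n≡m (ℕP.n≤1+n (suc n))))
    length≡ : length (A ⊕ C) ≡ suc (suc n)
    length≡ = Eq.trans (length-⊕ A C)
      (Eq.trans (Eq.cong (_⊔ length C) A≡2+n) (ℕP.m≥n⇒m⊔n≡m (ℕP.m≤n⇒m≤1+n C≤1+n)))
    lead≈ : coeff (A ⊕ C) (suc n) ≈ 1#
    lead≈ = begin
      coeff (A ⊕ C) (suc n)                           ≈⟨ coeff-⊕ A C (suc n) ⟩
      coeff A (suc n) + coeff C (suc n)               ≈⟨ +-cong (coeff-⊕ (X* p) (β · p) (suc n))
                                                                (coeff-≥length C (suc n) C≤1+n) ⟩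
      (coeff p n + coeff (β · p) (suc n)) + 0#        ≈⟨ +-identityʳ _ ⟩
      coeff p n + coeff (β · p) (suc n)               ≈⟨ +-cong lead≈1 (coeff-≥length (β · p) (suc n)
                                                                (ℕP.≤-reflexive βp≡1+n)) ⟩
      1# + 0#                                         ≈⟨ +-identityʳ 1# ⟩
      1#                                              ∎

  dot : Poly → (ℕ → Carrier) → Carrier
  dot []      σ = 0#
  dot (x ∷ p) σ = x * σ 0 + dot p (λ j → σ (suc j))

  dot-congʳ : ∀ p {σ τ} → (∀ j → σ j ≈ τ j) → dot p σ ≈ dot p τ
  dot-congʳ []      σ≈τ = refl
  dot-congʳ (x ∷ p) σ≈τ = +-cong (*-congˡ (σ≈τ 0)) (dot-congʳ p (λ j → σ≈τ (suc j)))

  dot-vanishing : ∀ p σ → (∀ j → j < length p → σ j ≈ 0#) → dot p σ ≈ 0#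
  dot-vanishing []      σ σ≈0 = refl
  dot-vanishing (x ∷ p) σ σ≈0 = trans
    (+-cong (*-annihilatesʳ x (σ≈0 0 (s≤s z≤n))) (dot-vanishing p _ (λ j j<p → σ≈0 (suc j) (s≤s j<p))))
    (+-identityʳ 0#)

  dot-single : ∀ p σ i → (∀ j → j < length p → j ≢ i → σ j ≈ 0#) → dot p σ ≈ coeff p i * σ i
  dot-single []      σ i       _   = sym (zeroˡ (σ i))
  dot-single (x ∷ p) σ zero    σ≈0 = trans
    (+-congˡ (dot-vanishing p _ (λ j j<p → σ≈0 (suc j) (s≤s j<p) (λ ()))))
    (+-identityʳ _)
  dot-single (x ∷ p) σ (suc i) σ≈0 = trans
    (+-cong (*-annihilatesʳ x (σ≈0 0 (s≤s z≤n) (λ ())))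
            (dot-single p _ i (λ j j<p j≢i → σ≈0 (suc j) (s≤s j<p) (λ { Eq.refl → j≢i Eq.refl }))))
    (+-identityˡ _)

  dot≈0⇒term≈0 : ∀ p σ i → ¬ (coeff p i ≈ 0#) → dot p σ ≈ 0# →
                 (∀ j → j < length p → j ≢ i → σ j ≈ 0#) → σ i ≈ 0#
  dot≈0⇒term≈0 p σ i pᵢ≉0 dot≈0 σ≈0 =
    x≉0∧x*y≈0⇒y≈0 pᵢ≉0 (trans (sym (dot-single p σ i σ≈0)) dot≈0)

  apply-shiftL : ∀ μ s p → apply μ (shiftL s p) ≈ dot p (λ j → μ (s ℤ.+ + j))
  apply-shiftL μ s []      = refl
  apply-shiftL μ s (x ∷ p) = +-cong
    (*-congˡ (reflexive (Eq.cong μ (Eq.sym (ℤP.+-identityʳ s)))))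
    (trans (apply-shiftL μ (s ℤ.+ + 1) p)
           (dot-congʳ p (λ j → reflexive (Eq.cong μ (ℤP.+-assoc s (+ 1) (+ j))))))

  apply-shiftL-neg : ∀ μ n p → apply μ (shiftL (ℤ.- (+ n)) p) ≈ dot p (λ j → μ (j ⊖ n))
  apply-shiftL-neg μ n p = trans (apply-shiftL μ (ℤ.- (+ n)) p)
    (dot-congʳ p (λ j → reflexive (Eq.cong μ (ℤP.-m+n≡n⊖m n j))))

  apply-shiftL-· : ∀ μ s k p → apply μ (shiftL s (k · p)) ≈ k * apply μ (shiftL s p)
  apply-shiftL-· μ s k []      = sym (zeroʳ k)
  apply-shiftL-· μ s k (x ∷ p) = begin
    (k * x) * μ s + apply μ (shiftL (s ℤ.+ + 1) (k · p))
      ≈⟨ +-cong (*-assoc k x (μ s)) (apply-shiftL-· μ (s ℤ.+ + 1) k p) ⟩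
    k * (x * μ s) + k * apply μ (shiftL (s ℤ.+ + 1) p)
      ≈⟨ sym (distribˡ k _ _) ⟩
    k * (x * μ s + apply μ (shiftL (s ℤ.+ + 1) p)) ∎

  shiftL-++ : ∀ s p q → shiftL s (p ++ q) ≡ shiftL s p ++ shiftL (s ℤ.+ + length p) q
  shiftL-++ s []      q = Eq.cong (λ r → shiftL r q) (Eq.sym (ℤP.+-identityʳ s))
  shiftL-++ s (x ∷ p) q = Eq.cong ((s , x) ∷_) (Eq.trans (shiftL-++ (s ℤ.+ + 1) p q)
    (Eq.cong (λ r → shiftL (s ℤ.+ + 1) p ++ shiftL r q) (ℤP.+-assoc s (+ 1) (+ length p))))

  apply-++ : ∀ μ f g → apply μ (f ++ g) ≈ apply μ f + apply μ g
  apply-++ μ []            g = sym (+-identityˡ _)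
  apply-++ μ ((k , x) ∷ f) g = trans (+-congˡ (apply-++ μ f g)) (sym (+-assoc _ _ _))

  apply-one : ∀ μ → apply μ one ≈ μ (+ 0)
  apply-one μ = trans (+-identityʳ _) (*-identityˡ _)

  dual-moment : ∀ μ k → dual μ k ≈ μ (ℤ.- k)
  dual-moment μ k = trans (+-identityʳ _) (*-identityˡ _)

  dual-one : ∀ μ → apply μ one ≈ 1# → apply (dual μ) one ≈ 1#
  dual-one μ μ1≈1 = trans (apply-one (dual μ)) (trans (dual-moment μ (+ 0)) (trans (sym (apply-one μ)) μ1≈1))

  apply-invertL : ∀ μ ν → (∀ k → ν k ≈ dual μ k) → ∀ f → apply ν f ≈ apply μ (invertL f)
  apply-invertL μ ν ν≈μ∨ []            = refl
  apply-invertL μ ν ν≈μ∨ ((k , x) ∷ f) =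
    +-cong (*-congˡ (trans (ν≈μ∨ k) (dual-moment μ k))) (apply-invertL μ ν ν≈μ∨ f)

  -- x^s · x^{|p|-1} p(x⁻¹), inverted, is x^t p(x) with t = 1 - s - |p|.
  apply-dual-shiftL-reverse : ∀ μ p s t → (t ℤ.+ s) ℤ.+ + length p ≡ + 1 →
                              apply (dual μ) (shiftL s (reverse p)) ≈ apply μ (shiftL t p)
  apply-dual-shiftL-reverse μ []      s t _ = refl
  apply-dual-shiftL-reverse μ (x ∷ p) s t t+s+|xp|≡1
    rewrite LP.unfold-reverse x p | shiftL-++ s (reverse p) [ x ] | LP.length-reverse p = begin
    apply (dual μ) (shiftL s (reverse p) ++ shiftL (s ℤ.+ + L) [ x ])
      ≈⟨ apply-++ (dual μ) (shiftL s (reverse p)) _ ⟩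
    apply (dual μ) (shiftL s (reverse p)) + (x * dual μ (s ℤ.+ + L) + 0#)
      ≈⟨ +-cong (apply-dual-shiftL-reverse μ p s (t ℤ.+ + 1) (Eq.trans (regroup t s (+ L)) t+s+|xp|≡1))
                (trans (+-identityʳ _) (*-congˡ (dual-moment μ _))) ⟩
    apply μ (shiftL (t ℤ.+ + 1) p) + x * μ (ℤ.- (s ℤ.+ + L))
      ≡⟨ Eq.cong (λ z → apply μ (shiftL (t ℤ.+ + 1) p) + x * μ z) (negate t s (+ L) t+s+|xp|≡1) ⟩
    apply μ (shiftL (t ℤ.+ + 1) p) + x * μ t
      ≈⟨ +-comm _ _ ⟩
    x * μ t + apply μ (shiftL (t ℤ.+ + 1) p) ∎
    where
    L : ℕ
    L = length p

    regroup : ∀ t s l → ((t ℤ.+ + 1) ℤ.+ s) ℤ.+ l ≡ (t ℤ.+ s) ℤ.+ (+ 1 ℤ.+ l)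
    regroup = solve-∀

    t-as-difference : ∀ t s l → t ≡ ((t ℤ.+ s) ℤ.+ (+ 1 ℤ.+ l)) ℤ.- + 1 ℤ.- (s ℤ.+ l)
    t-as-difference = solve-∀

    negate : ∀ t s l → (t ℤ.+ s) ℤ.+ (+ 1 ℤ.+ l) ≡ + 1 → ℤ.- (s ℤ.+ l) ≡ t
    negate t s l e = Eq.sym (Eq.trans (t-as-difference t s l)
      (Eq.trans (Eq.cong (λ z → z ℤ.- + 1 ℤ.- (s ℤ.+ l)) e) (ℤP.+-identityˡ (ℤ.- (s ℤ.+ l)))))

  infixl 6 _-ᶠ_
  _-ᶠ_ : Functional → Functional → Functional
  (μ -ᶠ ν) k = μ k - ν k

  apply-ᶠ : ∀ μ ν f → apply (μ -ᶠ ν) f ≈ apply μ f - apply ν f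
  apply-ᶠ μ ν []            = sym (-‿inverseʳ 0#)
  apply-ᶠ μ ν ((k , x) ∷ f) = begin
    x * (μ k - ν k) + apply (μ -ᶠ ν) f
      ≈⟨ +-cong (x[y-z]≈xy-xz x (μ k) (ν k)) (apply-ᶠ μ ν f) ⟩
    (x * μ k - x * ν k) + (apply μ f - apply ν f)
      ≈⟨ interchange _ _ _ _ ⟩
    (x * μ k + apply μ f) + (- (x * ν k) + - apply ν f)
      ≈⟨ +-congˡ (-‿+-comm _ _) ⟩
    (x * μ k + apply μ f) - (x * ν k + apply ν f) ∎

  apply-ᶠ-≈ : ∀ μ ν f {r} → apply μ f ≈ r → apply ν f ≈ r → apply (μ -ᶠ ν) f ≈ 0#
  apply-ᶠ-≈ μ ν f μf≈r νf≈r =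
    trans (apply-ᶠ μ ν f) (trans (+-cong μf≈r (-‿cong νf≈r)) (-‿inverseʳ _))

  -ᶠ≈0⇒≈ : ∀ μ ν → (∀ k → (μ -ᶠ ν) k ≈ 0#) → ∀ k → μ k ≈ ν k
  -ᶠ≈0⇒≈ μ ν μ-ν≈0 k = x∙y⁻¹≈ε⇒x≈y (μ k) (ν k) (μ-ν≈0 k)

  module Uniqueness (Q : ℕ → Poly) (length-Q : ∀ m → length (Q m) ≡ suc m)
                    (head≉0 : ∀ m → 1 ≤ m → ¬ (coeff (Q m) 0 ≈ 0#))
                    (last≉0 : ∀ m → 1 ≤ m → ¬ (coeff (Q m) m ≈ 0#)) where

    head-vanishes : ∀ m σ → 1 ≤ m → dot (Q m) σ ≈ 0# → (∀ j → j < m → σ (suc j) ≈ 0#) → σ 0 ≈ 0#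
    head-vanishes m σ 1≤m dot≈0 tail≈0 = dot≈0⇒term≈0 (Q m) σ 0 (head≉0 m 1≤m) dot≈0 tail≈0′
      where
      tail≈0′ : ∀ j → j < length (Q m) → j ≢ 0 → σ j ≈ 0#
      tail≈0′ zero    _       0≢0 = ⊥-elim (0≢0 Eq.refl)
      tail≈0′ (suc j) 1+j<Q _     = tail≈0 j (s≤s⁻¹ (Eq.subst (suc j <_) (length-Q m) 1+j<Q))

    last-vanishes : ∀ m σ → 1 ≤ m → dot (Q m) σ ≈ 0# → (∀ {j} → j < m → σ j ≈ 0#) → σ m ≈ 0#
    last-vanishes m σ 1≤m dot≈0 init≈0 = dot≈0⇒term≈0 (Q m) σ m (last≉0 m 1≤m) dot≈0
      (λ j j<Q j≢m → init≈0 (ℕP.≤∧≢⇒< (s≤s⁻¹ (Eq.subst (j <_) (length-Q m) j<Q)) j≢m))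

    module _ (δ : Functional) (δ₀≈0 : δ (+ 0) ≈ 0#) where

      ⊖-suc : ∀ n j → δ (suc j ⊖ suc n) ≈ δ (j ⊖ n)
      ⊖-suc n j = reflexive (Eq.cong δ (ℤP.[1+m]⊖[1+n]≡m⊖n j n))

      F-conditions⇒zero : (∀ n m → n < m → dot (Q m) (λ j → δ (j ⊖ n)) ≈ 0#) → ∀ k → δ k ≈ 0#
      F-conditions⇒zero annihilates = λ { (+ i) → above 0 i ; -[1+ n ] → above (suc n) 0 }
        where
        nonneg : ∀ i → δ (+ i) ≈ 0#
        nonneg = <-rec _ λ
          { zero    _    → δ₀≈0
          ; (suc k) below → last-vanishes (suc k) _ (s≤s z≤n) (annihilates 0 (suc k) (s≤s z≤n)) below }

        above : ∀ n j → δ (j ⊖ n) ≈ 0#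
        above zero    j       = nonneg j
        above (suc n) zero    = head-vanishes (suc (suc n)) _ (s≤s z≤n)
          (annihilates (suc n) (suc (suc n)) ℕP.≤-refl) (λ j _ → trans (⊖-suc n j) (above n j))
        above (suc n) (suc j) = trans (⊖-suc n j) (above n j)

      L-conditions⇒zero : (∀ n m → 0 < n → n ≤ m → dot (Q m) (λ j → δ (j ⊖ n)) ≈ 0#) →
                          ∀ k → δ k ≈ 0#
      L-conditions⇒zero annihilates = λ { (+ i) → from-1 (suc i) ; -[1+ n ] → nonpos (suc n) 0 z≤n }
        where
        nonpos : ∀ n j → j ≤ n → δ (j ⊖ n) ≈ 0#
        nonpos zero    zero    z≤n       = δ₀≈0
        nonpos (suc n) zero    _         = head-vanishes (suc n) _ (s≤s z≤n)
          (annihilates (suc n) (suc n) (s≤s z≤n) ℕP.≤-refl)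
          (λ j j<1+n → trans (⊖-suc n j) (nonpos n j (s≤s⁻¹ j<1+n)))
        nonpos (suc n) (suc j) (s≤s j≤n) = trans (⊖-suc n j) (nonpos n j j≤n)

        from-1 : ∀ i → δ (i ⊖ 1) ≈ 0#
        from-1 = <-rec _ λ
          { zero    _     → nonpos 1 0 z≤n
          ; (suc k) below → last-vanishes (suc k) _ (s≤s z≤n)
                              (annihilates 1 (suc k) (s≤s z≤n) (s≤s z≤n)) below }

    -ᶠ-moment₀ : ∀ {μ ν} → apply μ one ≈ 1# → apply ν one ≈ 1# → (μ -ᶠ ν) (+ 0) ≈ 0#
    -ᶠ-moment₀ {μ} {ν} μ1≈1 ν1≈1 = trans (sym (apply-one (μ -ᶠ ν))) (apply-ᶠ-≈ μ ν one μ1≈1 ν1≈1)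

    -ᶠ-annihilates : ∀ {μ ν} n m → apply μ (shiftL (ℤ.- (+ n)) (Q m)) ≈ 0# →
                     apply ν (shiftL (ℤ.- (+ n)) (Q m)) ≈ 0# → dot (Q m) (λ j → (μ -ᶠ ν) (j ⊖ n)) ≈ 0#
    -ᶠ-annihilates {μ} {ν} n m μ-annihilates ν-annihilates = trans
      (sym (apply-shiftL-neg (μ -ᶠ ν) n (Q m)))
      (apply-ᶠ-≈ μ ν (shiftL (ℤ.- (+ n)) (Q m)) μ-annihilates ν-annihilates)

    IsF-unique : ∀ μ ν → IsF Q μ → IsF Q ν → ∀ k → μ k ≈ ν k
    IsF-unique μ ν (μ1≈1 , μ-annihilates) (ν1≈1 , ν-annihilates) = -ᶠ≈0⇒≈ μ ν
      (F-conditions⇒zero (μ -ᶠ ν) (-ᶠ-moment₀ {μ} {ν} μ1≈1 ν1≈1) λ n m n<m →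
        -ᶠ-annihilates {μ} {ν} n m (μ-annihilates n m n<m) (ν-annihilates n m n<m))

    IsL-unique : ∀ μ ν → IsL Q μ → IsL Q ν → ∀ k → μ k ≈ ν k
    IsL-unique μ ν (μ1≈1 , μ-annihilates) (ν1≈1 , ν-annihilates) = -ᶠ≈0⇒≈ μ ν
      (L-conditions⇒zero (μ -ᶠ ν) (-ᶠ-moment₀ {μ} {ν} μ1≈1 ν1≈1) λ n m 0<n n≤m →
        -ᶠ-annihilates {μ} {ν} n m (μ-annihilates n m 0<n n≤m) (ν-annihilates n m 0<n n≤m))

  module Reversal (Q : ℕ → Poly) (length-Q : ∀ m → length (Q m) ≡ suc m) (κ : ℕ → Carrier) where

    Q∨ : ℕ → Poly
    Q∨ m = κ m · reverse (Q m)

    dual-annihilates : ∀ μ n k → apply μ (shiftL (ℤ.- (+ k)) (Q (n ℕ.+ k))) ≈ 0# →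
                       apply (dual μ) (shiftL (ℤ.- (+ n)) (Q∨ (n ℕ.+ k))) ≈ 0#
    dual-annihilates μ n k annihilates = trans
      (apply-shiftL-· (dual μ) (ℤ.- (+ n)) (κ (n ℕ.+ k)) (reverse (Q (n ℕ.+ k))))
      (*-annihilatesʳ _ (trans (apply-dual-shiftL-reverse μ (Q (n ℕ.+ k)) (ℤ.- (+ n)) (ℤ.- (+ k)) exponents)
                            annihilates))
      where
      exponents : (ℤ.- (+ k) ℤ.+ ℤ.- (+ n)) ℤ.+ + length (Q (n ℕ.+ k)) ≡ + 1
      exponents rewrite length-Q (n ℕ.+ k) = solve (+ k) (+ n)
        where
        solve : ∀ k n → (ℤ.- k ℤ.+ ℤ.- n) ℤ.+ (+ 1 ℤ.+ (n ℤ.+ k)) ≡ + 1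
        solve = solve-∀

    annihilates-at : ∀ {μ} n m → n ≤ m → apply μ (shiftL (ℤ.- (+ (m ∸ n))) (Q m)) ≈ 0# →
                     apply (dual μ) (shiftL (ℤ.- (+ n)) (Q∨ m)) ≈ 0#
    annihilates-at {μ} n m n≤m annihilates =
      Eq.subst (λ m′ → apply (dual μ) (shiftL (ℤ.- (+ n)) (Q∨ m′)) ≈ 0#) (ℕP.m+[n∸m]≡n n≤m)
        (dual-annihilates μ n (m ∸ n) (Eq.subst (λ m′ → apply μ (shiftL (ℤ.- (+ (m ∸ n))) (Q m′)) ≈ 0#)
                                                (Eq.sym (ℕP.m+[n∸m]≡n n≤m)) annihilates))

    IsL⇒IsF-dual : ∀ μ → IsL Q μ → IsF Q∨ (dual μ)
    IsL⇒IsF-dual μ (μ1≈1 , annihilates) = dual-one μ μ1≈1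
      , λ n m n<m → annihilates-at n m (ℕP.<⇒≤ n<m)
                      (annihilates (m ∸ n) m (ℕP.m<n⇒0<n∸m n<m) (ℕP.m∸n≤m m n))

    IsF⇒IsL-dual : ∀ μ → IsF Q μ → IsL Q∨ (dual μ)
    IsF⇒IsL-dual μ (μ1≈1 , annihilates) = dual-one μ μ1≈1
      , λ n m 0<n n≤m → annihilates-at n m n≤m (annihilates (m ∸ n) m (ℕP.∸-monoʳ-< 0<n n≤m))

  module InvertedPolynomials (b a : ℕ → Carrier)
                             (P₀≉0 : ∀ n → 1 ≤ n → ¬ (at0 (P b a n) ≈ 0#)) where

    Ppair-shape : ∀ n → (length (proj₁ (Ppair b a n)) ≤ n) × IsMonicOfDegree n (proj₂ (Ppair b a n))
    Ppair-shape zero    = z≤n , Eq.refl , refl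
    Ppair-shape (suc n) with Ppair-shape n
    ... | p₋≤n , p-monic@(p≡1+n , _) = ℕP.≤-reflexive p≡1+n
      , monic-recurrence (- b n) (- a n) (proj₁ (Ppair b a n)) (proj₂ (Ppair b a n)) p₋≤n p-monic

    P-monic : ∀ n → IsMonicOfDegree n (P b a n)
    P-monic n = proj₂ (Ppair-shape n)

    Pinv-length : ∀ m → length (Pinv b a m) ≡ suc m
    Pinv-length m = Eq.trans (length-· _ (reverse (P b a m)))
      (Eq.trans (LP.length-reverse (P b a m)) (proj₁ (P-monic m)))

    κ : ℕ → Carrier
    κ m = at0 (P b a m) ⁻¹

    coeff-Pinv : ∀ m j → j < suc m → coeff (Pinv b a m) j ≈ κ m * coeff (P b a m) (m ∸ j)
    coeff-Pinv m j j≤m = trans (coeff-· (κ m) (reverse (P b a m)) j) (*-congˡ (reflexive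
      (Eq.trans (coeff-reverse (P b a m) j (Eq.subst (j <_) (Eq.sym |P|≡1+m) j≤m))
                (Eq.cong (λ L → coeff (P b a m) (L ∸ suc j)) |P|≡1+m))))
      where
      |P|≡1+m : length (P b a m) ≡ suc m
      |P|≡1+m = proj₁ (P-monic m)

    Pinv-head≉0 : ∀ m → 1 ≤ m → ¬ (coeff (Pinv b a m) 0 ≈ 0#)
    Pinv-head≉0 m 1≤m head≈0 = ⁻¹-≉0 (P₀≉0 m 1≤m) (begin
      κ m                                ≈⟨ sym (*-identityʳ _) ⟩
      κ m * 1#                           ≈⟨ *-congˡ (sym (proj₂ (P-monic m))) ⟩
      κ m * coeff (P b a m) (m ∸ 0)      ≈⟨ sym (coeff-Pinv m 0 (s≤s z≤n)) ⟩
      coeff (Pinv b a m) 0               ≈⟨ head≈0 ⟩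
      0#                                 ∎)

    Pinv-last≉0 : ∀ m → 1 ≤ m → ¬ (coeff (Pinv b a m) m ≈ 0#)
    Pinv-last≉0 m 1≤m last≈0 = 0≉1 (begin
      0#                                 ≈⟨ sym last≈0 ⟩
      coeff (Pinv b a m) m               ≈⟨ coeff-Pinv m m ℕP.≤-refl ⟩
      κ m * coeff (P b a m) (m ∸ m)      ≡⟨ Eq.cong (κ m *_) constant-term ⟩
      κ m * at0 (P b a m)                ≈⟨ *-comm _ _ ⟩
      at0 (P b a m) * κ m                ≈⟨ ⁻¹-inverse _ (P₀≉0 m 1≤m) ⟩
      1#                                 ∎)
      where
      constant-term : coeff (P b a m) (m ∸ m) ≡ at0 (P b a m)
      constant-term = Eq.trans (Eq.cong (coeff (P b a m)) (ℕP.n∸n≡0 m)) (coeff-zero (P b a m))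

    open Reversal (P b a) (λ m → proj₁ (P-monic m)) κ public
      using (IsL⇒IsF-dual; IsF⇒IsL-dual)
    open Uniqueness (Pinv b a) Pinv-length Pinv-head≉0 Pinv-last≉0 public
      using (IsF-unique; IsL-unique)

proposition4p6 : ∀ {c ℓ : Level} (F : Field c ℓ) (b a : ℕ → Field.Carrier F) →
    let open Field F in
    let open FieldTheory F in
    (∀ n → 1 ≤ n → ¬ (at0 (P b a n) ≈ 0#)) →
    (∀ n → 1 ≤ n → ¬ (a n ≈ 0#)) →
    ((∀ μ → IsL (P b a) μ → IsF (Pinv b a) (dual μ))
    × (∀ μ ν → IsL (P b a) μ → IsF (Pinv b a) ν → ∀ f → apply ν f ≈ apply μ (invertL f)))
    ×
    ((∀ μ → IsF (P b a) μ → IsL (Pinv b a) (dual μ))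
    × (∀ μ ν → IsF (P b a) μ → IsL (Pinv b a) ν → ∀ f → apply ν f ≈ apply μ (invertL f)))
proposition4p6 F b a P₀≉0 _ =
    (IsL⇒IsF-dual , λ μ ν μ-L ν-F →
       apply-invertL μ ν (IsF-unique ν (dual μ) ν-F (IsL⇒IsF-dual μ μ-L)))
  , (IsF⇒IsL-dual , λ μ ν μ-F ν-L →
       apply-invertL μ ν (IsL-unique ν (dual μ) ν-L (IsF⇒IsL-dual μ μ-F)))
  where
  open FieldTheory F using (dual)
  open Inversion F
  open InvertedPolynomials b a P₀≉0
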